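{- Let $A=A_2\times A_{2'}$ be a finite abelian group of even order, where $A_2$ is its Sylow $2$-subgroup and $A_{2'}$ its Hall $2'$-subgroup (the elements of odd order), and let $H=H_2\times H_{2'}$ be a subgroup of $A$ with $H_2\le A_2$ and $H_{2'}\le A_{2'}$. If $H$ is a subgroup perfect code of $A$, then $H_2$ is a subgroup perfect code of $A_2$.
   Context: Groups are written additively. For an abelian group $B$, an element $x\in B$ is a square if $x=2y$ for some $y\in B$; a subset is square-free if it contains no squares. For a square-free $T\subseteq B$, $\mathrm{CayS}(B,T)$ is the simple graph with vertex set $B$ where distinct $x,y$ are adjacent iff $x+y\in T$. A subset $C$ of vertices of a graph is a perfect code if every vertex is at distance at most one from exactly one vertex of $C$. A subgroup $H$ of $B$ is a subgroup perfect code of $B$ if $H$ is a perfect code of $\mathrm{CayS}(B,T)$ for some square-free $T\subseteq B$. -}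

module Defs where

open import Data.Nat using (ℕ; _*_; _^_)
open import Data.Nat.Divisibility using (_∣_)
open import Data.Fin using (Fin)
open import Data.Fin.Properties using (*↔×)
open import Data.Product using (Σ; ∃; _×_; _,_; proj₁; proj₂)
open import Data.Product.Function.NonDependent.Propositional using (_×-↔_)
open import Data.Sum using (_⊎_)
open import Function.Bundles using (_↔_)
open import Function.Properties.Inverse using (↔-trans)
open import Relation.Nullary using (¬_)
open import Relation.Binary.PropositionalEquality
  using (_≡_; _≢_; refl; cong; cong₂; isEquivalence)
open import Algebra.Structures using (IsAbelianGroup)

record FiniteAbelianGroup : Set₁ where
  infixl 6 _+_
  field
    Carrier        : Set
    _+_            : Carrier → Carrier → Carrier
    0#             : Carrier
    -_             : Carrier → Carrier
    isAbelianGroup : IsAbelianGroup _≡_ _+_ 0# -_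
    order          : ℕ
    enum           : Fin order ↔ Carrier

open FiniteAbelianGroup public using (Carrier; order)

_⊕_ : FiniteAbelianGroup → FiniteAbelianGroup → FiniteAbelianGroup
G ⊕ K = record
  { Carrier        = G.Carrier × K.Carrier
  ; _+_            = λ x y → (proj₁ x G.+ proj₁ y) , (proj₂ x K.+ proj₂ y)
  ; 0#             = G.0# , K.0#
  ; -_             = λ x → (G.- proj₁ x) , (K.- proj₂ x)
  ; isAbelianGroup = record
    { isGroup = record
      { isMonoid = record
        { isSemigroup = record
          { isMagma = record
            { isEquivalence = isEquivalence
            ; ∙-cong = λ p q → cong₂ (λ x y → (proj₁ x G.+ proj₁ y) , (proj₂ x K.+ proj₂ y)) p q }
          ; assoc = λ x y z → cong₂ _,_ (GA.assoc _ _ _) (KA.assoc _ _ _) }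
        ; identity = (λ x → cong₂ _,_ (proj₁ GA.identity _) (proj₁ KA.identity _))
                   , (λ x → cong₂ _,_ (proj₂ GA.identity _) (proj₂ KA.identity _)) }
      ; inverse = (λ x → cong₂ _,_ (proj₁ GA.inverse _) (proj₁ KA.inverse _))
                , (λ x → cong₂ _,_ (proj₂ GA.inverse _) (proj₂ KA.inverse _))
      ; ⁻¹-cong = λ p → cong (λ x → (G.- proj₁ x) , (K.- proj₂ x)) p }
    ; comm = λ x y → cong₂ _,_ (GA.comm _ _) (KA.comm _ _) }
  ; order          = G.order * K.order
  ; enum           = ↔-trans *↔× (G.enum ×-↔ K.enum)
  }
  where
    module G = FiniteAbelianGroup G
    module K = FiniteAbelianGroup K
    module GA = IsAbelianGroup G.isAbelianGroup
    module KA = IsAbelianGroup K.isAbelianGroup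

module _ (B : FiniteAbelianGroup) where
  open FiniteAbelianGroup B hiding (Carrier)
  private C = Carrier B

  record IsSubgroup (H : C → Set) : Set where
    field
      0∈  : H 0#
      +∈  : ∀ {x y} → H x → H y → H (x + y)
      -∈  : ∀ {x} → H x → H (- x)

  IsSquare : C → Set
  IsSquare x = ∃ λ y → y + y ≡ x

  SquareFree : (C → Set) → Set
  SquareFree T = ∀ x → T x → ¬ IsSquare x

  CaySAdj : (C → Set) → C → C → Set
  CaySAdj T x y = x ≢ y × T (x + y)

module _ {V : Set} (Adj : V → V → Set) where

  Dist≤1 : V → V → Set
  Dist≤1 c v = c ≡ v ⊎ Adj c v

  IsPerfectCode : (V → Set) → Set
  IsPerfectCode C =
    (∀ v → Σ V λ c → C c × Dist≤1 c v) ×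
    (∀ v c c′ → C c → C c′ → Dist≤1 c v → Dist≤1 c′ v → c ≡ c′)

SubgroupPerfectCode : (B : FiniteAbelianGroup) → (Carrier B → Set) → Set₁
SubgroupPerfectCode B H =
  IsSubgroup B H ×
  Σ (Carrier B → Set) λ T → SquareFree B T × IsPerfectCode (CaySAdj B T) H

Is2Group : FiniteAbelianGroup → Set
Is2Group B = ∃ λ k → order B ≡ 2 ^ k

HasOddOrder : FiniteAbelianGroup → Set
HasOddOrder B = ¬ (2 ∣ order B)

module Submission where

-- Write G = A₂ and K = A₂′.  Because |K| is odd, every element
-- of K is a square: |K|·k = 0 for all k, and |K| = 2m+1 gives k = 2((m+1)·k).
-- Given a square-free connection set T ⊆ G × K for which H₂ × H₂′ is a perfect
-- code of CayS(G ⊕ K, T), project it to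
--     T₂ = { g ∈ G | (g , h) ∈ T for some h ∈ H₂′ } ⊆ G.
-- T₂ is square-free, since a square g = 2y together with h = 2z would make
-- (g , h) = 2(y , z) a square in T.  H₂ is a perfect code of CayS(G, T₂):
-- a vertex v is covered in G by the first coordinate of the code vertex
-- covering (v , 0), and two code vertices covering v in G lift to code
-- vertices covering (v , 0) in G ⊕ K, which coincide by uniqueness there.
--
-- The proposition is the combination of the two.

open import Defs
open import Data.Nat as ℕ using (ℕ; zero; suc)
open import Data.Nat.Properties using (+-suc)
open import Data.Nat.Divisibility using (_∣_; divides)
open import Data.Fin.Permutation using (Permutation′; _⟨$⟩ʳ_)
open import Data.Product using (Σ; ∃; _×_; _,_; proj₁; proj₂)
open import Data.Sum using (inj₁; inj₂)
open import Data.Empty using (⊥-elim)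
open import Data.Vec.Functional using (replicate)
open import Relation.Nullary using (¬_)
open import Function.Bundles using (_↔_; Inverse; mk↔ₛ′)
open import Function.Properties.Inverse using (↔-sym; ↔-trans)
open import Relation.Binary.PropositionalEquality
open import Algebra.Bundles using (Group; CommutativeMonoid)
open import Algebra.Structures using (IsAbelianGroup)
import Algebra.Properties.Group as GroupProperties
import Algebra.Properties.CommutativeMonoid.Sum as SumProperties
import Algebra.Properties.Monoid.Mult as MultProperties

2∤2+n⇒2∤n : ∀ {n} → ¬ (2 ∣ suc (suc n)) → ¬ (2 ∣ n)
2∤2+n⇒2∤n 2∤2+n (divides q n≡q*2) = 2∤2+n (divides (suc q) (cong (λ x → suc (suc x)) n≡q*2))

odd⇒1+2m : ∀ n → ¬ (2 ∣ n) → ∃ λ m → n ≡ suc (m ℕ.+ m)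
odd⇒1+2m zero          2∤n   = ⊥-elim (2∤n (divides 0 refl))
odd⇒1+2m (suc zero)    _     = 0 , refl
odd⇒1+2m (suc (suc n)) 2∤2+n with odd⇒1+2m n (2∤2+n⇒2∤n 2∤2+n)
... | m , n≡1+2m = suc m , cong (λ x → suc (suc x)) (trans n≡1+2m (sym (+-suc m m)))

module FiniteAbelianGroupProperties (G : FiniteAbelianGroup) where
  open FiniteAbelianGroup G renaming (Carrier to C; order to |G|)
  open IsAbelianGroup isAbelianGroup using (isGroup; isCommutativeMonoid; identityʳ)

  group : Group _ _
  group = record { isGroup = isGroup }

  commutativeMonoid : CommutativeMonoid _ _
  commutativeMonoid = record { isCommutativeMonoid = isCommutativeMonoid }

  open GroupProperties group using (identityʳ-unique; //-rightDividesˡ; //-rightDividesʳ)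
  open SumProperties commutativeMonoid using (sum; sum-cong-≗; ∑-permute; ∑-distrib-+; sum-replicate)
  open MultProperties (CommutativeMonoid.monoid commutativeMonoid) renaming (_×_ to _·_) using (×-homo-+)
  module E = Inverse enum

  translation : C → C ↔ C
  translation h = mk↔ₛ′ (_+ h) (λ x → x + (- h)) (//-rightDividesˡ h) (//-rightDividesʳ h)

  translationPermutation : C → Permutation′ |G|
  translationPermutation h = ↔-trans enum (↔-trans (translation h) (↔-sym enum))

  -- Summing all elements before and after translating by h gives
  -- Σ x = Σ (x + h) = Σ x + |G|·h, so |G|·h = 0 (the abelian Lagrange theorem).
  order-annihilates : ∀ h → |G| · h ≡ 0#
  order-annihilates h = identityʳ-unique total (|G| · h) (sym total≡total+|G|h)
    where
    open ≡-Reasoning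
    total : C
    total = sum E.to
    total≡total+|G|h : total ≡ total + |G| · h
    total≡total+|G|h = begin
      total                                              ≡⟨ ∑-permute E.to (translationPermutation h) ⟩
      sum (λ i → E.to (translationPermutation h ⟨$⟩ʳ i)) ≡⟨ sum-cong-≗ (λ i → E.strictlyInverseˡ (E.to i + h)) ⟩
      sum (λ i → E.to i + replicate |G| h i)             ≡⟨ ∑-distrib-+ E.to (replicate |G| h) ⟩
      total + sum (replicate |G| h)                      ≡⟨ cong (total +_) (sum-replicate |G|) ⟩
      total + |G| · h                                    ∎

  -- In a group of odd order |G| = 2m + 1 every h is the square of (m + 1)·h.
  odd-order⇒square : ¬ (2 ∣ |G|) → ∀ h → IsSquare G h
  odd-order⇒square 2∤|G| h with odd⇒1+2m |G| 2∤|G|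
  ... | m , |G|≡1+2m = suc m · h , (begin
    suc m · h + suc m · h  ≡⟨ ×-homo-+ h (suc m) (suc m) ⟨
    (suc m ℕ.+ suc m) · h  ≡⟨ cong (λ k → suc k · h) (trans (+-suc m m) (sym |G|≡1+2m)) ⟩
    h + |G| · h            ≡⟨ cong (h +_) (order-annihilates h) ⟩
    h + 0#                 ≡⟨ identityʳ h ⟩
    h                      ∎)
    where open ≡-Reasoning

module Projection (G K : FiniteAbelianGroup) (H : Carrier G → Set) (H′ : Carrier K → Set) where
  module G = FiniteAbelianGroup G
  module K = FiniteAbelianGroup K
  open IsAbelianGroup K.isAbelianGroup using (identityʳ)

  module _ (T : Carrier (G ⊕ K) → Set) where

    T₂ : Carrier G → Set
    T₂ g = ∃ λ h → H′ h × T (g , h)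

    T₂-squareFree : (∀ k → IsSquare K k) → SquareFree (G ⊕ K) T → SquareFree G T₂
    T₂-squareFree square sqf g (h , _ , g,h∈T) (y , 2y≡g) with square h
    ... | z , 2z≡h = sqf (g , h) g,h∈T ((y , z) , cong₂ _,_ 2y≡g 2z≡h)

    -- The edge between (c , h) and (v , 0) in CayS(G ⊕ K, T) is labelled (c + v , h + 0).
    drop-0 : ∀ {g h} → T (g , h K.+ K.0#) → T (g , h)
    drop-0 = subst (λ k → T (_ , k)) (identityʳ _)

    add-0 : ∀ {g h} → T (g , h) → T (g , h K.+ K.0#)
    add-0 = subst (λ k → T (_ , k)) (sym (identityʳ _))

    lift-cover : H′ K.0# → ∀ {c v} → Dist≤1 (CaySAdj G T₂) c v →
                 ∃ λ h → H′ h × Dist≤1 (CaySAdj (G ⊕ K) T) (c , h) (v , K.0#)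
    lift-cover 0∈H′ (inj₁ c≡v)                        = K.0# , 0∈H′ , inj₁ (cong₂ _,_ c≡v refl)
    lift-cover 0∈H′ (inj₂ (c≢v , h , h∈H′ , c+v,h∈T)) =
      h , h∈H′ , inj₂ ((λ c,h≡v,0 → c≢v (cong proj₁ c,h≡v,0)) , add-0 c+v,h∈T)

    projected-perfectCode : H′ K.0# → IsPerfectCode (CaySAdj (G ⊕ K) T) (λ x → H (proj₁ x) × H′ (proj₂ x)) →
                            IsPerfectCode (CaySAdj G T₂) H
    projected-perfectCode 0∈H′ (cover , unique) = cover₂ , unique₂
      where
      -- v is covered by the first coordinate c of the code vertex covering (v , 0);
      -- an edge there has c ≠ v, since otherwise (v , 0) itself would be a second
      -- code vertex covering (v , 0).
      cover₂ : ∀ v → Σ (Carrier G) λ c → H c × Dist≤1 (CaySAdj G T₂) c v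
      cover₂ v with cover (v , K.0#)
      ... | (c , h) , (c∈H , h∈H′) , inj₁ c,h≡v,0 = c , c∈H , inj₁ (cong proj₁ c,h≡v,0)
      ... | (c , h) , (c∈H , h∈H′) , inj₂ (c,h≢v,0 , edge) =
            c , c∈H , inj₂ (c≢v , h , h∈H′ , drop-0 edge)
        where
        c≢v : c ≢ v
        c≢v refl = c,h≢v,0 (unique (c , K.0#) (c , h) (c , K.0#) (c∈H , h∈H′) (c∈H , 0∈H′)
                                   (inj₂ (c,h≢v,0 , edge)) (inj₁ refl))

      unique₂ : ∀ v c c′ → H c → H c′ → Dist≤1 (CaySAdj G T₂) c v →
                Dist≤1 (CaySAdj G T₂) c′ v → c ≡ c′
      unique₂ v c c′ c∈H c′∈H c-covers c′-covers
        with lift-cover 0∈H′ c-covers | lift-cover 0∈H′ c′-covers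
      ... | h , h∈H′ , lifted | h′ , h′∈H′ , lifted′ =
        cong proj₁ (unique (v , K.0#) (c , h) (c′ , h′) (c∈H , h∈H′) (c′∈H , h′∈H′) lifted lifted′)

  subgroupPerfectCode-projects : (∀ k → IsSquare K k) → IsSubgroup G H → IsSubgroup K H′ →
    SubgroupPerfectCode (G ⊕ K) (λ x → H (proj₁ x) × H′ (proj₂ x)) → SubgroupPerfectCode G H
  subgroupPerfectCode-projects square H≤G H′≤K (_ , T , sqf , perfect) =
    H≤G , T₂ T , T₂-squareFree T square sqf , projected-perfectCode T (IsSubgroup.0∈ H′≤K) perfect

proposition3p8 : (A₂ A₂′ : FiniteAbelianGroup) →
    Is2Group A₂ → HasOddOrder A₂′ → 2 ∣ order (A₂ ⊕ A₂′) →
    (H₂ : Carrier A₂ → Set) (H₂′ : Carrier A₂′ → Set) →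
    IsSubgroup A₂ H₂ → IsSubgroup A₂′ H₂′ →
    SubgroupPerfectCode (A₂ ⊕ A₂′) (λ x → H₂ (proj₁ x) × H₂′ (proj₂ x)) →
    SubgroupPerfectCode A₂ H₂
proposition3p8 A₂ A₂′ _ |A₂′|-odd _ H₂ H₂′ =
  Projection.subgroupPerfectCode-projects A₂ A₂′ H₂ H₂′
    (FiniteAbelianGroupProperties.odd-order⇒square A₂′ |A₂′|-odd)
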